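{- Let $B$ be a Boolean program expression, $r$ a state predicate and $S$ a statement on state space $\Sigma$. Let $W \neq \emptyset$ be a well-founded set with order $<$, let $p$ be a state predicate (the invariant) and $v : \Sigma \to W$ (the variant), and put $p_w = p \wedge (\lambda\sigma.\ v\,\sigma = w)$ for $w \in W$ and $p_{<w} = \lambda \sigma.\ \exists w' \in W.\ w' < w \wedge p_{w'}\,\sigma$. Then \[\big(\forall w \in W\cdot \{p_w \wedge \mathsf{def}\,B \wedge \mathsf{val}\,B\}\ S\ \{p_{<w}, r\}\big) \Rightarrow \{p\}\ \mathsf{while}\ B\ \mathsf{do}\ S\ \{p \wedge \mathsf{def}\,B \wedge \neg\mathsf{val}\,B,\ (p \wedge \neg\mathsf{def}\,B) \vee r\}\] and \[\big(\forall w \in W\cdot \{|p_w \wedge \mathsf{def}\,B \wedge \mathsf{val}\,B|\}\ S\ \{|p_{<w}, r|\}\big) \Rightarrow \{|p|\}\ \mathsf{while}\ B\ \mathsf{do}\ S\ \{|p \wedge \mathsf{def}\,B \wedge \neg\mathsf{val}\,B,\ r|\}.\]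
   Context: A state predicate on $\Sigma$ is a function $\Sigma\to Bool$; logical operations are pointwise and $u \le v$ iff $\forall\sigma.\ u\,\sigma\Rightarrow v\,\sigma$. A statement on $\Sigma$ is a monotonic predicate transformer $S : \mathcal P\Sigma\times\mathcal P\Sigma\to\mathcal P\Sigma$, where $S(q,r)$ is the weakest precondition for terminating normally in $q$ or exceptionally in $r$. Definitions: $\mathsf{skip}(q,r)=q$, $(S;T)(q,r)=S(T(q,r),r)$, $(S\sqcap T)(q,r)=S(q,r)\wedge T(q,r)$, $[u,v](q,r)=(u\Rightarrow q)\wedge(v\Rightarrow r)$, $[u](q,r) = (u\Rightarrow q)$. A Boolean program expression $B$ has a definedness predicate $\mathsf{def}\,B$ and a value predicate $\mathsf{val}\,B$. Conditional: $\mathsf{if}\ B\ \mathsf{then}\ S\ \mathsf{else}\ T = [\mathsf{def}\,B,\neg\mathsf{def}\,B];(([\mathsf{val}\,B];S)\sqcap([\neg\mathsf{val}\,B];T))$. Total refinement $S\sqsubseteq T$ iff $\forall q,r.\ S(q,r)\le T(q,r)$; statements form a complete lattice under it. Loop: $\mathsf{while}\ B\ \mathsf{do}\ S = \mu(\lambda X.\ \mathsf{if}\ B\ \mathsf{then}\ S;X\ \mathsf{else}\ \mathsf{skip})$, the least fixed point w.r.t. $\sqsubseteq$. Total correctness: $\{p\}\ S\ \{q,r\} = (p \le S(q,r))$. Partial correctness: $\{|p|\}\ S\ \{|q,r|\} = (p \le S(q, p\vee r))$. -}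

module Defs where

open import Data.Product using (_×_; _,_; Σ-syntax; ∃-syntax)
open import Data.Sum using (_⊎_)
open import Relation.Nullary using (¬_)
open import Relation.Binary.PropositionalEquality using (_≡_)

Pred : Set → Set₁
Pred St = St → Set

module _ {St : Set} where

  infixr 6 _∧_
  infixr 5 _∨_
  infix 4 _≤ₚ_

  _∧_ : Pred St → Pred St → Pred St
  (u ∧ v) σ = u σ × v σ

  _∨_ : Pred St → Pred St → Pred St
  (u ∨ v) σ = u σ ⊎ v σ

  ∼_ : Pred St → Pred St
  (∼ u) σ = ¬ u σ

  _⇒ₚ_ : Pred St → Pred St → Pred St
  (u ⇒ₚ v) σ = u σ → v σ

  _≤ₚ_ : Pred St → Pred St → Set
  u ≤ₚ v = ∀ σ → u σ → v σ

record Stmt (St : Set) : Set₁ where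
  field
    wp   : Pred St → Pred St → Pred St
    mono : ∀ {q q' r r'} → q ≤ₚ q' → r ≤ₚ r' → wp q r ≤ₚ wp q' r'
open Stmt public

module _ {St : Set} where

  infix 4 _⊑_ _≈ₛ_
  _⊑_ : Stmt St → Stmt St → Set₁
  S ⊑ T = ∀ q r → wp S q r ≤ₚ wp T q r

  _≈ₛ_ : Stmt St → Stmt St → Set₁
  S ≈ₛ T = (S ⊑ T) × (T ⊑ S)

  skip : Stmt St
  wp skip q r = q
  mono skip hq hr = hq

  infixr 4 _⨾_
  _⨾_ : Stmt St → Stmt St → Stmt St
  wp (S ⨾ T) q r = wp S (wp T q r) r
  mono (S ⨾ T) hq hr = mono S (mono T hq hr) hr

  _⊓_ : Stmt St → Stmt St → Stmt St
  wp (S ⊓ T) q r = wp S q r ∧ wp T q r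
  mono (S ⊓ T) hq hr σ (a , b) = mono S hq hr σ a , mono T hq hr σ b

  assume₂ : Pred St → Pred St → Stmt St
  wp (assume₂ u v) q r = (u ⇒ₚ q) ∧ (v ⇒ₚ r)
  mono (assume₂ u v) hq hr σ (a , b) = (λ x → hq σ (a x)) , (λ x → hr σ (b x))

  assume : Pred St → Stmt St
  wp (assume u) q r = u ⇒ₚ q
  mono (assume u) hq hr σ a x = hq σ (a x)

record BoolExpr (St : Set) : Set₁ where
  field
    def : Pred St
    val : Pred St
open BoolExpr public

module _ {St : Set} where

  if_then_else_ : BoolExpr St → Stmt St → Stmt St → Stmt St
  if B then S else T =
    assume₂ (def B) (∼ def B) ⨾ ((assume (val B) ⨾ S) ⊓ (assume (∼ val B) ⨾ T))

  loopF : BoolExpr St → Stmt St → Stmt St → Stmt St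
  loopF B S X = if B then (S ⨾ X) else skip

  IsLeastFixedPoint : (Stmt St → Stmt St) → Stmt St → Set₁
  IsLeastFixedPoint F X = (F X ≈ₛ X) × (∀ Y → F Y ≈ₛ Y → X ⊑ Y)

  IsWhile : BoolExpr St → Stmt St → Stmt St → Set₁
  IsWhile B S X = IsLeastFixedPoint (loopF B S) X

  ⟪_⟫_⟪_,_⟫ : Pred St → Stmt St → Pred St → Pred St → Set
  ⟪ p ⟫ S ⟪ q , r ⟫ = p ≤ₚ wp S q r

  ⦃|_|⦄_⦃|_,_|⦄ : Pred St → Stmt St → Pred St → Pred St → Set
  ⦃| p |⦄ S ⦃| q , r |⦄ = p ≤ₚ wp S q (p ∨ r)

module _ {St W : Set} where
  pAt : Pred St → (St → W) → W → Pred St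
  pAt p v w σ = p σ × v σ ≡ w

  pBelow : (W → W → Set) → Pred St → (St → W) → W → Pred St
  pBelow _<_ p v w σ = ∃[ w' ] (w' < w × pAt p v w' σ)

-- Well-founded induction on the variant: unfolding the loop once (it is a
-- fixed point of its body functional), an iteration from p_w either exits in
-- the postcondition or runs the body into p_{<w}, where the induction
-- hypothesis applies. The
-- partial-correctness rule is the total one with exceptional postcondition
-- p ∨ r.
module Submission where

open import Defs
open import Data.Product using (_×_; _,_; proj₁)
open import Data.Sum using (inj₁; inj₂; [_,_])
open import Induction.WellFounded using (WellFounded; WfRec; module All)
open import Function using (_∘_)
open import Relation.Binary.PropositionalEquality using (refl)

module _ {St : Set} where

  ⟪⟫-weakenʳ : ∀ {p q r r'} (S : Stmt St) → r ≤ₚ r'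
             → ⟪ p ⟫ S ⟪ q , r ⟫ → ⟪ p ⟫ S ⟪ q , r' ⟫
  ⟪⟫-weakenʳ S r≤r' h σ pσ = mono S (λ _ x → x) r≤r' σ (h σ pσ)

  module _ (B : BoolExpr St) (S : Stmt St) where

    if-loopF : ∀ {X q r σ}
             → (def B σ → val B σ → wp S (wp X q r) r σ)
             → (def B σ → (∼ val B) σ → q σ)
             → ((∼ def B) σ → r σ)
             → wp (loopF B S X) q r σ
    if-loopF body exit abort = (λ d → body d , exit d) , abort

    while-variant : {W : Set} {_<_ : W → W → Set} → WellFounded _<_
                  → (p r : Pred St) (v : St → W)
                  → (X : Stmt St) → loopF B S X ⊑ X
                  → p ∧ ∼ def B ≤ₚ r
                  → (∀ w → ⟪ pAt p v w ∧ def B ∧ val B ⟫ S ⟪ pBelow _<_ p v w , r ⟫)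
                  → ⟪ p ⟫ X ⟪ p ∧ def B ∧ ∼ val B , r ⟫
    while-variant {W} {_<_} wf p r v X unfold abort body σ pσ =
      All.wfRec wf _ Establishes step (v σ) σ (pσ , refl)
      where
      Q : Pred St
      Q = p ∧ def B ∧ ∼ val B

      Establishes : W → Set
      Establishes w = pAt p v w ≤ₚ wp X Q r

      step : ∀ w → WfRec _<_ Establishes w → Establishes w
      step w ih τ pτ@(inv , _) = unfold Q r τ (if-loopF {X} {Q} {r}
        (λ d t → mono S below (λ _ x → x) τ (body w τ (pτ , d , t)))
        (λ d f → inv , d , f)
        (λ nd → abort τ (inv , nd)))
        where
        below : pBelow _<_ p v w ≤ₚ wp X Q r
        below τ' (w' , w'<w , pτ') = ih w'<w τ' pτ'

theorem4 : {St : Set} (B : BoolExpr St) (r : Pred St) (S : Stmt St)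
    (W : Set) (_<_ : W → W → Set) → WellFounded _<_ → W
    → (p : Pred St) (v : St → W)
    → (While : Stmt St) → IsWhile B S While
    → ((∀ w → ⟪ pAt p v w ∧ def B ∧ val B ⟫ S ⟪ pBelow _<_ p v w , r ⟫)
    → ⟪ p ⟫ While ⟪ p ∧ def B ∧ ∼ val B , (p ∧ ∼ def B) ∨ r ⟫)
    × ((∀ w → ⦃| pAt p v w ∧ def B ∧ val B |⦄ S ⦃| pBelow _<_ p v w , r |⦄)
    → ⦃| p |⦄ While ⦃| p ∧ def B ∧ ∼ val B , r |⦄)
theorem4 B r S W _<_ wf _ p v While ((unfold , _) , _) = total , partial
  where
  total : (∀ w → ⟪ pAt p v w ∧ def B ∧ val B ⟫ S ⟪ pBelow _<_ p v w , r ⟫)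
        → ⟪ p ⟫ While ⟪ p ∧ def B ∧ ∼ val B , (p ∧ ∼ def B) ∨ r ⟫
  total body = while-variant B S wf p _ v While unfold (λ _ → inj₁)
    (λ w → ⟪⟫-weakenʳ S (λ _ → inj₂) (body w))

  partial : (∀ w → ⦃| pAt p v w ∧ def B ∧ val B |⦄ S ⦃| pBelow _<_ p v w , r |⦄)
          → ⦃| p |⦄ While ⦃| p ∧ def B ∧ ∼ val B , r |⦄
  partial body = while-variant B S wf p _ v While unfold (λ _ → inj₁ ∘ proj₁)
    (λ w → ⟪⟫-weakenʳ S (λ _ → [ inj₁ ∘ proj₁ ∘ proj₁ , inj₂ ]) (body w))
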